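{- For every integer $n\ge0$, \[ x^n=\sum_{j=0}^n(-1)^j\binom{2n+1}{j}P_{n-j}(x)=(-1)^n\binom{2n}{n}+\sum_{j=0}^{n-1}(-1)^j\binom{2n}{j}Q_{n-j}(x), \] \[ x^n=\sum_{j=0}^n(-1)^j\binom{2n+1}{j}\frac{2n+1-2j}{2n+1}\mathcal{P}_{n-j}(x), \] and for every integer $n\ge1$, \[ x^n=\sum_{j=0}^{n-1}(-1)^j\binom{2n}{j}\frac{2n-2j}{2n}\mathcal{Q}_{n-j}(x). \] Hence each of the four families $(P_m)_{m\ge0}$, $(Q_m)_{m\ge0}$, $(\mathcal{P}_m)_{m\ge0}$, $(\mathcal{Q}_m)_{m\ge0}$ forms a basis of the vector space of polynomials.
   Context: For integers $n,k\ge0$: $T_k(n)=\binom{n+k+1}{2k+1}+\binom{n+k}{2k+1}$, $U_k(n)=\binom{n+k}{2k}+\binom{n+k-1}{2k}$ for $k\ge1$ and $U_0(n)=2$. $P_n(x)=\sum_{k=0}^nT_k(n)x^k$, $Q_n(x)=\sum_{k=0}^nU_k(n)x^k$, $\mathcal{P}_n(x)=\sum_{k=0}^n\binom{n+k}{2k}x^k$, $\mathcal{Q}_n(x)=\sum_{k=1}^n\binom{n+k-1}{2k-1}x^k$ for $n\ge1$ and $\mathcal{Q}_0(x)=1$. -}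

module Defs where

open import Data.Nat using (ℕ; zero; suc; _+_; _*_; _∸_; _≤ᵇ_)
open import Data.Bool using (if_then_else_)
open import Data.Integer using (ℤ; +_)
import Data.Integer as ℤ
open import Data.Rational using (ℚ; 0ℚ; 1ℚ; -_; _/_)
import Data.Rational as Q
open import Data.List using (List; []; _∷_)
open import Data.List.Relation.Unary.All using (All)
open import Data.Product using (Σ; _×_)
open import Relation.Binary.PropositionalEquality using (_≡_)

binom : ℕ → ℕ → ℕ
binom n zero = 1
binom zero (suc k) = 0
binom (suc n) (suc k) = binom n k + binom n (suc k)

ℕ→ℚ : ℕ → ℚ
ℕ→ℚ n = + n / 1

sgn : ℕ → ℚ
sgn zero = 1ℚ
sgn (suc j) = - sgn j

sumTo : ℕ → (ℕ → ℚ) → ℚ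
sumTo zero f = f 0
sumTo (suc n) f = sumTo n f Q.+ f (suc n)

sumBelow : ℕ → (ℕ → ℚ) → ℚ
sumBelow zero f = 0ℚ
sumBelow (suc n) f = sumBelow n f Q.+ f n

-- A polynomial in ℚ[x] is represented by its coefficient function:
-- Poly p means: p k = coefficient of x^k.  Equality of polynomials is
-- coefficientwise equality.
Poly : Set
Poly = ℕ → ℚ

upTo : ℕ → (ℕ → ℕ) → Poly
upTo n c k = if k ≤ᵇ n then ℕ→ℚ (c k) else 0ℚ

X^ : ℕ → Poly
X^ n k = if k ≤ᵇ n then (if n ≤ᵇ k then 1ℚ else 0ℚ) else 0ℚ

T : ℕ → ℕ → ℕ
T k n = binom (n + k + 1) (2 * k + 1) + binom (n + k) (2 * k + 1)

U : ℕ → ℕ → ℕ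
U zero n = 2
U (suc k) n = binom (n + suc k) (2 * suc k) + binom (n + suc k ∸ 1) (2 * suc k)

P : ℕ → Poly
P n = upTo n (λ k → T k n)

Qp : ℕ → Poly
Qp n = upTo n (λ k → U k n)

calP : ℕ → Poly
calP n = upTo n (λ k → binom (n + k) (2 * k))

calQ : ℕ → Poly
calQ zero = X^ 0
calQ (suc m) = upTo (suc m) c
  where
  c : ℕ → ℕ
  c zero = 0
  c (suc k) = binom (suc m + suc k ∸ 1) (2 * suc k ∸ 1)

lincomb : (ℕ → Poly) → List ℚ → Poly
lincomb F [] k = 0ℚ
lincomb F (c ∷ cs) k = c Q.* F 0 k Q.+ lincomb (λ i → F (suc i)) cs k

fromList : List ℚ → Poly
fromList [] k = 0ℚ
fromList (a ∷ as) zero = a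
fromList (a ∷ as) (suc k) = fromList as k

IsBasis : (ℕ → Poly) → Set
IsBasis F =
  ((p : List ℚ) → Σ (List ℚ) (λ cs → (k : ℕ) → lincomb F cs k ≡ fromList p k))
  × ((cs : List ℚ) → ((k : ℕ) → lincomb F cs k ≡ 0ℚ) → All (_≡ 0ℚ) cs)

-- Read coefficientwise, each sum is a Cauchy product (u ⋆ f) n = Σ_j u j · f (n - j) of
-- alt a j = (-1)^j C(a, j), the coefficients of (1 - x)^a, with a column i ↦ C(i + r, b) of
-- Pascal's triangle, the coefficients of x^(b - r) / (1 - x)^(b + 1).  For k ≥ 1 the
-- coefficient of x^k in P_m or Q_m is a sum of two adjacent columns, and so is the one in
-- 𝒫_m or 𝒬_m once the weights are rewritten as C(2n+1, j)(2n+1-2j)/(2n+1) = C(2n, j) - C(2n, j-1).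
-- Each sum is therefore the coefficient of x^n in x^k (1 + x)(1 - x)^(2(n - k) - 1): it is 0
-- for n < k, 1 for n = k, and for n > k the sum of the two middle entries of an odd row of
-- signed binomials, which cancel.  The constant terms of Q_m reduce to the alternating sum of
-- an even row.  Finally every family is triangular with nonzero diagonal, hence a basis.

module Submission where

open import Defs
open import Data.Nat using (ℕ; zero; suc; _+_; _*_; _∸_; _≤_; _<_; z≤n; s≤s; _≤ᵇ_)
import Data.Nat.Properties as ℕP
open import Data.Nat.Tactic.RingSolver using (solve-∀)
open import Data.Integer using (+_)
import Data.Integer as ℤ
import Data.Integer.Properties as ℤP
import Data.Integer.Solver as ℤSolver
open import Data.Rational using (ℚ; _/_; 0ℚ; 1ℚ; toℚᵘ)
import Data.Rational as Q
import Data.Rational.Properties as QP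
import Data.Rational.Unnormalised as U
import Data.Rational.Unnormalised.Properties as UP
import Data.Rational.Solver as ℚSolver
open import Data.Bool using (true; false)
open import Data.List using (List; []; _∷_; _∷ʳ_; length)
import Data.List.Properties as LP
open import Data.List.Relation.Unary.All using (All; [])
import Data.List.Relation.Unary.All.Properties as AllP
open import Data.List.Reverse using (Reverse; []; _∶_∶ʳ_; reverseView)
open import Data.Product using (Σ; _×_; _,_)
open import Data.Sum using (inj₁; inj₂)
open import Relation.Binary.PropositionalEquality
open import Relation.Nullary.Reflects using (ofʸ; ofⁿ)
open import Relation.Nullary.Negation using (contradiction)
open import Relation.Binary.Definitions using (tri<; tri≈; tri>)

module ℤS = ℤSolver.+-*-Solver
module ℚS = ℚSolver.+-*-Solver

toℚᵘ-ℕ→ℚ : ∀ n → toℚᵘ (ℕ→ℚ n) U.≃ U.mkℚᵘ (+ n) 0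
toℚᵘ-ℕ→ℚ n = QP.toℚᵘ-fromℚᵘ (U.mkℚᵘ (+ n) 0)

ℕ→ℚ-+ : ∀ m n → ℕ→ℚ (m + n) ≡ ℕ→ℚ m Q.+ ℕ→ℚ n
ℕ→ℚ-+ m n = QP.toℚᵘ-injective (begin
    toℚᵘ (ℕ→ℚ (m + n))                      ≈⟨ toℚᵘ-ℕ→ℚ (m + n) ⟩
    U.mkℚᵘ (+ (m + n)) 0                     ≈⟨ U.*≡* integer-identity ⟩
    U.mkℚᵘ (+ m) 0 U.+ U.mkℚᵘ (+ n) 0       ≈⟨ UP.+-cong (toℚᵘ-ℕ→ℚ m) (toℚᵘ-ℕ→ℚ n) ⟨
    toℚᵘ (ℕ→ℚ m) U.+ toℚᵘ (ℕ→ℚ n)           ≈⟨ QP.toℚᵘ-homo-+ (ℕ→ℚ m) (ℕ→ℚ n) ⟨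
    toℚᵘ (ℕ→ℚ m Q.+ ℕ→ℚ n)                  ∎)
  where
  open UP.≃-Reasoning
  integer-identity : + (m + n) ℤ.* + 1 ≡ (+ m ℤ.* + 1 ℤ.+ + n ℤ.* + 1) ℤ.* + 1
  integer-identity = trans (cong (ℤ._* + 1) (ℤP.pos-+ m n))
    (ℤS.solve 2 (λ x y → (x ℤS.:+ y) ℤS.:* ℤS.con (+ 1)
                   ℤS.:= (x ℤS.:* ℤS.con (+ 1) ℤS.:+ y ℤS.:* ℤS.con (+ 1)) ℤS.:* ℤS.con (+ 1)) refl (+ m) (+ n))

binom-< : ∀ {n k} → n < k → binom n k ≡ 0
binom-< {zero}  {suc k} _       = refl
binom-< {suc n} {suc k} (s≤s h) = cong₂ _+_ (binom-< h) (binom-< (ℕP.m<n⇒m<1+n h))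

binom-diag : ∀ n → binom n n ≡ 1
binom-diag zero    = refl
binom-diag (suc n) = cong₂ _+_ (binom-diag n) (binom-< (ℕP.n<1+n n))

binom-sym : ∀ m n → binom (m + n) m ≡ binom (m + n) n
binom-sym zero    n       = sym (binom-diag n)
binom-sym (suc m) zero    rewrite ℕP.+-identityʳ m = binom-diag (suc m)
binom-sym (suc m) (suc n) = begin
    binom (m + suc n) m + binom (m + suc n) (suc m)
  ≡⟨ cong₂ _+_ (binom-sym m (suc n)) (subst (λ x → binom x (suc m) ≡ binom x n) (sym (ℕP.+-suc m n)) (binom-sym (suc m) n)) ⟩
    binom (m + suc n) (suc n) + binom (m + suc n) n
  ≡⟨ ℕP.+-comm (binom (m + suc n) (suc n)) _ ⟩
    binom (m + suc n) n + binom (m + suc n) (suc n) ∎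
  where open ≡-Reasoning

binom-absorb : ∀ M j → suc j * binom (suc M) (suc j) ≡ suc M * binom M j
binom-absorb zero    zero    = refl
binom-absorb zero    (suc j) = ℕP.*-zeroʳ (suc (suc j))
binom-absorb (suc M) zero    = cong suc (binom-absorb M zero)
binom-absorb (suc M) (suc j) = begin
    suc (suc j) * (A + B)              ≡⟨ expand j A B ⟩
    A + suc j * A + suc (suc j) * B    ≡⟨ cong₂ (λ u v → A + u + v) (binom-absorb M j) (binom-absorb M (suc j)) ⟩
    A + suc M * x + suc M * y          ≡⟨ collect A M x y ⟩
    A + suc M * A                      ∎
  where
  open ≡-Reasoning
  A = binom (suc M) (suc j)
  B = binom (suc M) (suc (suc j))
  x = binom M j
  y = binom M (suc j)
  expand : ∀ j A B → suc (suc j) * (A + B) ≡ A + suc j * A + suc (suc j) * B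
  expand = solve-∀
  collect : ∀ A M x y → A + suc M * x + suc M * y ≡ A + suc M * (x + y)
  collect = solve-∀

weight-identityℤ : ∀ m a b j → j ℤ.* (a ℤ.+ b) ≡ m ℤ.* b →
  (a ℤ.+ b) ℤ.* (m ℤ.- + 2 ℤ.* j) ℤ.* + 1 ≡ (a ℤ.* + 1 ℤ.+ ℤ.- b ℤ.* + 1) ℤ.* m
weight-identityℤ m a b j absorb = begin
    (a ℤ.+ b) ℤ.* (m ℤ.- + 2 ℤ.* j) ℤ.* + 1
      ≡⟨ ℤS.solve 4 (λ m a b j → (a ℤS.:+ b) ℤS.:* (m ℤS.:- ℤS.con (+ 2) ℤS.:* j) ℤS.:* ℤS.con (+ 1)
                                 ℤS.:= m ℤS.:* (a ℤS.:+ b) ℤS.:- ℤS.con (+ 2) ℤS.:* (j ℤS.:* (a ℤS.:+ b))) refl m a b j ⟩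
    m ℤ.* (a ℤ.+ b) ℤ.- + 2 ℤ.* (j ℤ.* (a ℤ.+ b))
      ≡⟨ cong (λ t → m ℤ.* (a ℤ.+ b) ℤ.- + 2 ℤ.* t) absorb ⟩
    m ℤ.* (a ℤ.+ b) ℤ.- + 2 ℤ.* (m ℤ.* b)
      ≡⟨ ℤS.solve 3 (λ m a b → m ℤS.:* (a ℤS.:+ b) ℤS.:- ℤS.con (+ 2) ℤS.:* (m ℤS.:* b)
                               ℤS.:= (a ℤS.:* ℤS.con (+ 1) ℤS.:+ ℤS.:- b ℤS.:* ℤS.con (+ 1)) ℤS.:* m) refl m a b ⟩
    (a ℤ.* + 1 ℤ.+ ℤ.- b ℤ.* + 1) ℤ.* m ∎
  where open ≡-Reasoning

binom-weight : ∀ M j {A B} → j * (A + B) ≡ suc M * B →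
  ℕ→ℚ (A + B) Q.* ((+ suc M ℤ.- + (2 * j)) / suc M) ≡ ℕ→ℚ A Q.- ℕ→ℚ B
binom-weight M j {A} {B} absorb = QP.toℚᵘ-injective (begin
    toℚᵘ (ℕ→ℚ (A + B) Q.* (z / suc M))         ≈⟨ QP.toℚᵘ-homo-* (ℕ→ℚ (A + B)) (z / suc M) ⟩
    toℚᵘ (ℕ→ℚ (A + B)) U.* toℚᵘ (z / suc M)
      ≈⟨ UP.*-cong (toℚᵘ-ℕ→ℚ (A + B)) (QP.toℚᵘ-fromℚᵘ (U.mkℚᵘ z M)) ⟩
    U.mkℚᵘ (+ (A + B)) 0 U.* U.mkℚᵘ z M        ≈⟨ U.*≡* integer-identity ⟩
    U.mkℚᵘ (+ A) 0 U.- U.mkℚᵘ (+ B) 0          ≈⟨ UP.+-cong (toℚᵘ-ℕ→ℚ A) (UP.-‿cong (toℚᵘ-ℕ→ℚ B)) ⟨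
    toℚᵘ (ℕ→ℚ A) U.- toℚᵘ (ℕ→ℚ B)
      ≈⟨ UP.+-cong (UP.≃-refl {toℚᵘ (ℕ→ℚ A)}) (QP.toℚᵘ-homo‿- (ℕ→ℚ B)) ⟨
    toℚᵘ (ℕ→ℚ A) U.+ toℚᵘ (Q.- ℕ→ℚ B)         ≈⟨ QP.toℚᵘ-homo-+ (ℕ→ℚ A) (Q.- ℕ→ℚ B) ⟨
    toℚᵘ (ℕ→ℚ A Q.- ℕ→ℚ B)                    ∎)
  where
  open UP.≃-Reasoning
  z = + suc M ℤ.- + (2 * j)
  m = + suc M
  absorbℤ : + j ℤ.* (+ A ℤ.+ + B) ≡ m ℤ.* + B
  absorbℤ = trans (cong (+ j ℤ.*_) (sym (ℤP.pos-+ A B)))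
           (trans (sym (ℤP.pos-* j (A + B))) (trans (cong +_ absorb) (ℤP.pos-* (suc M) B)))
  integer-identity : + (A + B) ℤ.* z ℤ.* + 1 ≡ (+ A ℤ.* + 1 ℤ.+ ℤ.- + B ℤ.* + 1) ℤ.* + suc (M + 0)
  integer-identity rewrite ℕP.+-identityʳ M | ℤP.pos-+ A B | ℤP.pos-* 2 j =
    weight-identityℤ m (+ A) (+ B) (+ j) absorbℤ

sumTo-cong : ∀ n {f g : ℕ → ℚ} → (∀ j → j ≤ n → f j ≡ g j) → sumTo n f ≡ sumTo n g
sumTo-cong zero    eq = eq 0 z≤n
sumTo-cong (suc n) eq = cong₂ Q._+_ (sumTo-cong n (λ j j≤n → eq j (ℕP.m≤n⇒m≤1+n j≤n))) (eq (suc n) ℕP.≤-refl)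

sumTo-+ : ∀ n (f g : ℕ → ℚ) → sumTo n (λ j → f j Q.+ g j) ≡ sumTo n f Q.+ sumTo n g
sumTo-+ zero    f g = refl
sumTo-+ (suc n) f g = trans (cong (Q._+ (f (suc n) Q.+ g (suc n))) (sumTo-+ n f g))
  (ℚS.solve 4 (λ a b c d → (a ℚS.:+ b) ℚS.:+ (c ℚS.:+ d) ℚS.:= (a ℚS.:+ c) ℚS.:+ (b ℚS.:+ d)) refl
    (sumTo n f) (sumTo n g) (f (suc n)) (g (suc n)))

sumTo-- : ∀ n (f g : ℕ → ℚ) → sumTo n (λ j → f j Q.- g j) ≡ sumTo n f Q.- sumTo n g
sumTo-- zero    f g = refl
sumTo-- (suc n) f g = trans (cong (Q._+ (f (suc n) Q.- g (suc n))) (sumTo-- n f g))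
  (ℚS.solve 4 (λ a b c d → (a ℚS.:- b) ℚS.:+ (c ℚS.:- d) ℚS.:= (a ℚS.:+ c) ℚS.:- (b ℚS.:+ d)) refl
    (sumTo n f) (sumTo n g) (f (suc n)) (g (suc n)))

sumTo-zero : ∀ n {f : ℕ → ℚ} → (∀ j → j ≤ n → f j ≡ 0ℚ) → sumTo n f ≡ 0ℚ
sumTo-zero zero    eq = eq 0 z≤n
sumTo-zero (suc n) eq = cong₂ Q._+_ (sumTo-zero n (λ j j≤n → eq j (ℕP.m≤n⇒m≤1+n j≤n))) (eq (suc n) ℕP.≤-refl)

sumTo-last : ∀ n {f : ℕ → ℚ} → (∀ j → j < n → f j ≡ 0ℚ) → sumTo n f ≡ f n
sumTo-last zero    _  = refl
sumTo-last (suc n) {f} eq = trans (cong (Q._+ f (suc n)) (sumTo-zero n (λ j j≤n → eq j (s≤s j≤n))))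
                                  (QP.+-identityˡ (f (suc n)))

sumTo-trunc : ∀ e n {f : ℕ → ℚ} → e ≤ n → (∀ j → e < j → j ≤ n → f j ≡ 0ℚ) → sumTo n f ≡ sumTo e f
sumTo-trunc e zero    z≤n _  = refl
sumTo-trunc e (suc n) {f} e≤1+n eq with ℕP.m≤n⇒m<n∨m≡n e≤1+n
... | inj₂ refl        = refl
... | inj₁ (s≤s e≤n) = begin
    sumTo n f Q.+ f (suc n) ≡⟨ cong (sumTo n f Q.+_) (eq (suc n) (s≤s e≤n) ℕP.≤-refl) ⟩
    sumTo n f Q.+ 0ℚ        ≡⟨ QP.+-identityʳ (sumTo n f) ⟩
    sumTo n f               ≡⟨ sumTo-trunc e n e≤n (λ j e<j j≤n → eq j e<j (ℕP.m≤n⇒m≤1+n j≤n)) ⟩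
    sumTo e f               ∎
  where open ≡-Reasoning

sumTo-peel : ∀ n (f : ℕ → ℚ) → sumTo (suc n) f ≡ f 0 Q.+ sumTo n (λ j → f (suc j))
sumTo-peel zero    f = refl
sumTo-peel (suc n) f = trans (cong (Q._+ f (suc (suc n))) (sumTo-peel n f)) (QP.+-assoc (f 0) _ _)

sumTo-sumBelow : ∀ n (f : ℕ → ℚ) → sumTo n f ≡ sumBelow n f Q.+ f n
sumTo-sumBelow zero    f = sym (QP.+-identityˡ (f 0))
sumTo-sumBelow (suc n) f = cong (Q._+ f (suc n)) (sumTo-sumBelow n f)

≡1⇒≢0 : ∀ {x} → x ≡ 1ℚ → x ≢ 0ℚ
≡1⇒≢0 x≡1 x≡0 with trans (sym x≡1) x≡0
... | ()

*-≢0-cancelʳ : ∀ x y → y ≢ 0ℚ → x Q.* y ≡ 0ℚ → x ≡ 0ℚ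
*-≢0-cancelʳ x y y≢0 xy≡0 = begin
    x                       ≡⟨ QP.*-identityʳ x ⟨
    x Q.* 1ℚ                ≡⟨ cong (x Q.*_) (QP.*-inverseʳ y) ⟨
    x Q.* (y Q.* Q.1/ y)    ≡⟨ QP.*-assoc x y (Q.1/ y) ⟨
    (x Q.* y) Q.* Q.1/ y    ≡⟨ cong (Q._* Q.1/ y) xy≡0 ⟩
    0ℚ Q.* Q.1/ y           ≡⟨ QP.*-zeroˡ (Q.1/ y) ⟩
    0ℚ                      ∎
  where
  open ≡-Reasoning
  instance
    y-nonZero : Q.NonZero y
    y-nonZero = Q.≢-nonZero y≢0

lincomb-∷ʳ : ∀ F cs x k → lincomb F (cs ∷ʳ x) k ≡ lincomb F cs k Q.+ x Q.* F (length cs) k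
lincomb-∷ʳ F []       x k = trans (QP.+-identityʳ (x Q.* F 0 k)) (sym (QP.+-identityˡ (x Q.* F 0 k)))
lincomb-∷ʳ F (c ∷ cs) x k = trans (cong (c Q.* F 0 k Q.+_) (lincomb-∷ʳ (λ i → F (suc i)) cs x k))
                                  (sym (QP.+-assoc (c Q.* F 0 k) _ _))

fromList-above : ∀ p k → length p ≤ k → fromList p k ≡ 0ℚ
fromList-above []      k       _       = refl
fromList-above (a ∷ p) (suc k) (s≤s h) = fromList-above p k h

lincomb-zero : ∀ F cs k → (∀ i → i < length cs → F i k ≡ 0ℚ) → lincomb F cs k ≡ 0ℚ
lincomb-zero F []       k _      = refl
lincomb-zero F (c ∷ cs) k F-zero = begin
    c Q.* F 0 k Q.+ lincomb (λ i → F (suc i)) cs k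
      ≡⟨ cong₂ (λ u v → c Q.* u Q.+ v) (F-zero 0 (s≤s z≤n))
               (lincomb-zero (λ i → F (suc i)) cs k (λ i i<n → F-zero (suc i) (s≤s i<n))) ⟩
    c Q.* 0ℚ Q.+ 0ℚ ≡⟨ cong (Q._+ 0ℚ) (QP.*-zeroʳ c) ⟩
    0ℚ Q.+ 0ℚ       ∎
  where open ≡-Reasoning

module _ (F : ℕ → Poly) (F-above : ∀ {m k} → m < k → F m k ≡ 0ℚ) (F-diag : ∀ m → F m m ≢ 0ℚ) where

  span : ∀ n (p : Poly) → (∀ {k} → n ≤ k → p k ≡ 0ℚ) →
         Σ (List ℚ) (λ cs → length cs ≡ n × (∀ k → lincomb F cs k ≡ p k))
  span zero    p p-above = [] , refl , λ k → sym (p-above z≤n)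
  span (suc n) p p-above = extend (span n p′ p′-above)
    where
    instance
      Fnn-nonZero : Q.NonZero (F n n)
      Fnn-nonZero = Q.≢-nonZero (F-diag n)
    c : ℚ
    c = p n Q.* Q.1/ F n n
    p′ : Poly
    p′ k = p k Q.- c Q.* F n k
    p′-above : ∀ {k} → n ≤ k → p′ k ≡ 0ℚ
    p′-above {k} n≤k with ℕP.m≤n⇒m<n∨m≡n n≤k
    ... | inj₁ n<k  = trans (cong₂ (λ u v → u Q.- c Q.* v) (p-above n<k) (F-above n<k))
                            (cong (λ t → 0ℚ Q.- t) (QP.*-zeroʳ c))
    ... | inj₂ refl = begin
        p n Q.- p n Q.* Q.1/ F n n Q.* F n n    ≡⟨ cong (Q._-_ (p n)) (QP.*-assoc (p n) _ _) ⟩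
        p n Q.- p n Q.* (Q.1/ F n n Q.* F n n)  ≡⟨ cong (λ t → p n Q.- p n Q.* t) (QP.*-inverseˡ (F n n)) ⟩
        p n Q.- p n Q.* 1ℚ                      ≡⟨ cong (Q._-_ (p n)) (QP.*-identityʳ (p n)) ⟩
        p n Q.- p n                             ≡⟨ QP.+-inverseʳ (p n) ⟩
        0ℚ                                      ∎
      where open ≡-Reasoning
    extend : Σ (List ℚ) (λ cs → length cs ≡ n × (∀ k → lincomb F cs k ≡ p′ k)) →
             Σ (List ℚ) (λ cs → length cs ≡ suc n × (∀ k → lincomb F cs k ≡ p k))
    extend (cs , refl , cs-spans) = cs ∷ʳ c , trans (LP.length-++ cs) (ℕP.+-comm (length cs) 1) , λ k →
      trans (lincomb-∷ʳ F cs c k)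
     (trans (cong (Q._+ c Q.* F (length cs) k) (cs-spans k))
            (ℚS.solve 2 (λ a b → (a ℚS.:- b) ℚS.:+ b ℚS.:= a) refl (p k) (c Q.* F (length cs) k)))

  independent : ∀ cs → (∀ k → lincomb F cs k ≡ 0ℚ) → All (_≡ 0ℚ) cs
  independent cs = from-end (reverseView cs)
    where
    from-end : ∀ {cs} → Reverse cs → (∀ k → lincomb F cs k ≡ 0ℚ) → All (_≡ 0ℚ) cs
    from-end []               _        = []
    from-end (xs ∶ rs ∶ʳ x) vanishes = AllP.∷ʳ⁺ (from-end rs xs-vanishes) x≡0
      where
      L = length xs
      x≡0 : x ≡ 0ℚ
      x≡0 = *-≢0-cancelʳ x (F L L) (F-diag L) (begin
        x Q.* F L L                          ≡⟨ QP.+-identityˡ _ ⟨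
        0ℚ Q.+ x Q.* F L L                   ≡⟨ cong (Q._+ x Q.* F L L) (lincomb-zero F xs L (λ i i<L → F-above i<L)) ⟨
        lincomb F xs L Q.+ x Q.* F L L       ≡⟨ lincomb-∷ʳ F xs x L ⟨
        lincomb F (xs ∷ʳ x) L                ≡⟨ vanishes L ⟩
        0ℚ                                   ∎)
        where open ≡-Reasoning
      xs-vanishes : ∀ k → lincomb F xs k ≡ 0ℚ
      xs-vanishes k = begin
        lincomb F xs k                       ≡⟨ QP.+-identityʳ _ ⟨
        lincomb F xs k Q.+ 0ℚ                ≡⟨ cong (lincomb F xs k Q.+_) (QP.*-zeroˡ (F L k)) ⟨
        lincomb F xs k Q.+ 0ℚ Q.* F L k      ≡⟨ cong (λ t → lincomb F xs k Q.+ t Q.* F L k) x≡0 ⟨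
        lincomb F xs k Q.+ x Q.* F L k       ≡⟨ lincomb-∷ʳ F xs x k ⟨
        lincomb F (xs ∷ʳ x) k                ≡⟨ vanishes k ⟩
        0ℚ                                   ∎
        where open ≡-Reasoning

  triangular-basis : IsBasis F
  triangular-basis = (λ p → let cs , _ , cs-spans = span (length p) (fromList p) (fromList-above p _) in cs , cs-spans)
                   , independent

≤ᵇ-true : ∀ {m n} → m ≤ n → (m ≤ᵇ n) ≡ true
≤ᵇ-true {m} {n} m≤n with m ≤ᵇ n | ℕP.≤ᵇ-reflects-≤ m n
... | true  | _       = refl
... | false | ofⁿ m≰n = contradiction m≤n m≰n

≤ᵇ-false : ∀ {m n} → n < m → (m ≤ᵇ n) ≡ false
≤ᵇ-false {m} {n} n<m with m ≤ᵇ n | ℕP.≤ᵇ-reflects-≤ m n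
... | false | _       = refl
... | true  | ofʸ m≤n = contradiction m≤n (ℕP.<⇒≱ n<m)

≤ᵇ-suc : ∀ m n → (suc m ≤ᵇ suc n) ≡ (m ≤ᵇ n)
≤ᵇ-suc zero    n = refl
≤ᵇ-suc (suc m) n = refl

X^-< : ∀ {n k} → n < k → X^ n k ≡ 0ℚ
X^-< n<k rewrite ≤ᵇ-false n<k = refl

X^-diag : ∀ n → X^ n n ≡ 1ℚ
X^-diag n rewrite ≤ᵇ-true (ℕP.≤-refl {n}) = refl

X^-> : ∀ {n k} → k < n → X^ n k ≡ 0ℚ
X^-> k<n rewrite ≤ᵇ-true (ℕP.<⇒≤ k<n) | ≤ᵇ-false k<n = refl

X^-suc : ∀ n k → X^ (suc n) (suc k) ≡ X^ n k
X^-suc n k rewrite ≤ᵇ-suc k n | ≤ᵇ-suc n k = refl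

delay : (ℕ → ℚ) → ℕ → ℚ
delay f zero    = 0ℚ
delay f (suc i) = f i

_⋆_ : (ℕ → ℚ) → (ℕ → ℚ) → ℕ → ℚ
(u ⋆ f) n = sumTo n (λ j → u j Q.* f (n ∸ j))

⋆-congˡ : ∀ {u v} f n → u ≗ v → (u ⋆ f) n ≡ (v ⋆ f) n
⋆-congˡ f n u≗v = sumTo-cong n (λ j _ → cong (Q._* f (n ∸ j)) (u≗v j))

⋆-congʳ : ∀ u {f g} n → f ≗ g → (u ⋆ f) n ≡ (u ⋆ g) n
⋆-congʳ u n f≗g = sumTo-cong n (λ j _ → cong (u j Q.*_) (f≗g (n ∸ j)))

⋆-distribˡ-+ : ∀ u f g n → (u ⋆ (λ i → f i Q.+ g i)) n ≡ (u ⋆ f) n Q.+ (u ⋆ g) n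
⋆-distribˡ-+ u f g n = trans (sumTo-cong n (λ j _ → QP.*-distribˡ-+ (u j) (f (n ∸ j)) (g (n ∸ j))))
                             (sumTo-+ n _ _)

⋆-distribʳ-+ : ∀ u v f n → ((λ j → u j Q.+ v j) ⋆ f) n ≡ (u ⋆ f) n Q.+ (v ⋆ f) n
⋆-distribʳ-+ u v f n = trans (sumTo-cong n (λ j _ → QP.*-distribʳ-+ (f (n ∸ j)) (u j) (v j)))
                             (sumTo-+ n _ _)

⋆-distribʳ-- : ∀ u v f n → ((λ j → u j Q.- v j) ⋆ f) n ≡ (u ⋆ f) n Q.- (v ⋆ f) n
⋆-distribʳ-- u v f n = trans (sumTo-cong n (λ j _ → distrib (u j) (v j) (f (n ∸ j))))
                             (sumTo-- n _ _)
  where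
  distrib : ∀ a b x → (a Q.- b) Q.* x ≡ a Q.* x Q.- b Q.* x
  distrib = ℚS.solve 3 (λ a b x → (a ℚS.:- b) ℚS.:* x ℚS.:= a ℚS.:* x ℚS.:- b ℚS.:* x) refl

⋆-delayʳ : ∀ u f n → (u ⋆ delay f) (suc n) ≡ (u ⋆ f) n
⋆-delayʳ u f n = begin
    sumTo n (λ j → u j Q.* delay f (suc n ∸ j)) Q.+ u (suc n) Q.* delay f (n ∸ n)
      ≡⟨ cong₂ (λ s i → s Q.+ u (suc n) Q.* delay f i)
               (sumTo-cong n (λ j j≤n → cong (λ i → u j Q.* delay f i) (ℕP.+-∸-assoc 1 j≤n))) (ℕP.n∸n≡0 n) ⟩
    (u ⋆ f) n Q.+ u (suc n) Q.* 0ℚ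
      ≡⟨ trans (cong ((u ⋆ f) n Q.+_) (QP.*-zeroʳ (u (suc n)))) (QP.+-identityʳ _) ⟩
    (u ⋆ f) n ∎
  where
  open ≡-Reasoning

⋆-delayˡ : ∀ u f n → (delay u ⋆ f) (suc n) ≡ (u ⋆ f) n
⋆-delayˡ u f n = trans (sumTo-peel n _)
  (trans (cong (Q._+ (u ⋆ f) n) (QP.*-zeroˡ (f (suc n)))) (QP.+-identityˡ ((u ⋆ f) n)))

delay-⋆ : ∀ u f n → (delay u ⋆ f) n ≡ (u ⋆ delay f) n
delay-⋆ u f zero    = trans (QP.*-zeroˡ (f 0)) (sym (QP.*-zeroʳ (u 0)))
delay-⋆ u f (suc n) = trans (⋆-delayˡ u f n) (sym (⋆-delayʳ u f n))

⋆-vanish : ∀ u {f q} n → (∀ i → i < q → f i ≡ 0ℚ) → n < q → (u ⋆ f) n ≡ 0ℚ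
⋆-vanish u n f-vanish n<q = sumTo-zero n (λ j _ →
  trans (cong (u j Q.*_) (f-vanish (n ∸ j) (ℕP.≤-<-trans (ℕP.m∸n≤m n j) n<q))) (QP.*-zeroʳ (u j)))

delay-vanish : ∀ {f q} → (∀ i → i < q → f i ≡ 0ℚ) → ∀ i → i < suc q → delay f i ≡ 0ℚ
delay-vanish f-vanish zero    _         = refl
delay-vanish f-vanish (suc i) (s≤s i<q) = f-vanish i i<q

⋆-shift : ∀ u {f} q e → (∀ i → i < q → f i ≡ 0ℚ) → (u ⋆ f) (q + e) ≡ (u ⋆ (λ i → f (q + i))) e
⋆-shift u {f} q e f-vanish = trans
  (sumTo-trunc e (q + e) (ℕP.m≤n+m e q) (λ j e<j j≤q+e →
    trans (cong (u j Q.*_) (f-vanish (q + e ∸ j) (subst (q + e ∸ j <_) (ℕP.m+n∸n≡m q e) (ℕP.∸-monoʳ-< e<j j≤q+e))))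
          (QP.*-zeroʳ (u j))))
  (sumTo-cong e (λ j j≤e → cong (λ i → u j Q.* f i) (ℕP.+-∸-assoc q j≤e)))

alt : ℕ → ℕ → ℚ
alt a j = sgn j Q.* ℕ→ℚ (binom a j)

alt-pascal : ∀ a j → alt (suc a) j ≡ alt a j Q.- delay (alt a) j
alt-pascal a zero    = refl
alt-pascal a (suc j) = trans (cong (Q.- sgn j Q.*_) (ℕ→ℚ-+ (binom a j) (binom a (suc j))))
  (ℚS.solve 3 (λ s x y → (ℚS.:- s) ℚS.:* (x ℚS.:+ y) ℚS.:= (ℚS.:- s) ℚS.:* y ℚS.:- s ℚS.:* x) refl
    (sgn j) (ℕ→ℚ (binom a j)) (ℕ→ℚ (binom a (suc j))))

alt-⋆-zero : ∀ a f → (alt a ⋆ f) 0 ≡ f 0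
alt-⋆-zero a f = QP.*-identityˡ (f 0)

alt-0-⋆ : ∀ f n → (alt 0 ⋆ f) n ≡ f n
alt-0-⋆ f n = trans (sumTo-trunc 0 n z≤n higher-terms) (QP.*-identityˡ (f n))
  where
  higher-terms : ∀ j → 0 < j → j ≤ n → alt 0 j Q.* f (n ∸ j) ≡ 0ℚ
  higher-terms (suc j) _ _ = trans (cong (Q._* f (n ∸ suc j)) (QP.*-zeroʳ (Q.- sgn j))) (QP.*-zeroˡ (f (n ∸ suc j)))

alt-suc-⋆ : ∀ a f n → (alt (suc a) ⋆ f) (suc n) ≡ (alt a ⋆ f) (suc n) Q.- (alt a ⋆ f) n
alt-suc-⋆ a f n = begin
    (alt (suc a) ⋆ f) (suc n)                                 ≡⟨ ⋆-congˡ f (suc n) (alt-pascal a) ⟩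
    ((λ j → alt a j Q.- delay (alt a) j) ⋆ f) (suc n)         ≡⟨ ⋆-distribʳ-- (alt a) (delay (alt a)) f (suc n) ⟩
    (alt a ⋆ f) (suc n) Q.- (delay (alt a) ⋆ f) (suc n)       ≡⟨ cong (Q._-_ ((alt a ⋆ f) (suc n))) (⋆-delayˡ (alt a) f n) ⟩
    (alt a ⋆ f) (suc n) Q.- (alt a ⋆ f) n                     ∎
  where open ≡-Reasoning

alt-+-⋆ : ∀ c a f n → (alt (c + a) ⋆ f) n ≡ (alt c ⋆ (alt a ⋆ f)) n
alt-+-⋆ zero    a f n       = sym (alt-0-⋆ (alt a ⋆ f) n)
alt-+-⋆ (suc c) a f zero    = trans (alt-⋆-zero (suc c + a) f)
                                     (sym (trans (alt-⋆-zero (suc c) (alt a ⋆ f)) (alt-⋆-zero a f)))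
alt-+-⋆ (suc c) a f (suc n) = begin
    (alt (suc (c + a)) ⋆ f) (suc n)                              ≡⟨ alt-suc-⋆ (c + a) f n ⟩
    (alt (c + a) ⋆ f) (suc n) Q.- (alt (c + a) ⋆ f) n             ≡⟨ cong₂ Q._-_ (alt-+-⋆ c a f (suc n)) (alt-+-⋆ c a f n) ⟩
    (alt c ⋆ (alt a ⋆ f)) (suc n) Q.- (alt c ⋆ (alt a ⋆ f)) n     ≡⟨ alt-suc-⋆ c (alt a ⋆ f) n ⟨
    (alt (suc c) ⋆ (alt a ⋆ f)) (suc n)                          ∎
  where open ≡-Reasoning

weighted-alt : ℕ → ℕ → ℚ
weighted-alt M j = alt (suc M) j Q.* ((+ suc M ℤ.- + (2 * j)) / suc M)

weighted-alt-split : ∀ M j → weighted-alt M j ≡ alt M j Q.+ delay (alt M) j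
weighted-alt-split M zero    = trans (QP.*-assoc 1ℚ (ℕ→ℚ 1) ((+ suc M ℤ.- + 0) / suc M))
  (cong (1ℚ Q.*_) (binom-weight M 0 {1} {0} (sym (ℕP.*-zeroʳ (suc M)))))
weighted-alt-split M (suc j) = begin
    Q.- sgn j Q.* ℕ→ℚ (x + y) Q.* w      ≡⟨ QP.*-assoc (Q.- sgn j) _ w ⟩
    Q.- sgn j Q.* (ℕ→ℚ (x + y) Q.* w)    ≡⟨ cong (λ t → Q.- sgn j Q.* (ℕ→ℚ t Q.* w)) (ℕP.+-comm x y) ⟩
    Q.- sgn j Q.* (ℕ→ℚ (y + x) Q.* w)    ≡⟨ cong (Q.- sgn j Q.*_) (binom-weight M (suc j) absorb) ⟩
    Q.- sgn j Q.* (ℕ→ℚ y Q.- ℕ→ℚ x)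
      ≡⟨ ℚS.solve 3 (λ s x y → (ℚS.:- s) ℚS.:* (y ℚS.:- x) ℚS.:= (ℚS.:- s) ℚS.:* y ℚS.:+ s ℚS.:* x) refl
                    (sgn j) (ℕ→ℚ x) (ℕ→ℚ y) ⟩
    alt M (suc j) Q.+ alt M j            ∎
  where
  open ≡-Reasoning
  x = binom M j
  y = binom M (suc j)
  w = (+ suc M ℤ.- + (2 * suc j)) / suc M
  absorb : suc j * (y + x) ≡ suc M * x
  absorb = trans (cong (suc j *_) (ℕP.+-comm y x)) (binom-absorb M j)

weighted-alt-⋆ : ∀ M f n → (weighted-alt M ⋆ f) n ≡ (alt M ⋆ f) n Q.+ (alt M ⋆ delay f) n
weighted-alt-⋆ M f n = begin
    (weighted-alt M ⋆ f) n                          ≡⟨ ⋆-congˡ f n (weighted-alt-split M) ⟩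
    ((λ j → alt M j Q.+ delay (alt M) j) ⋆ f) n   ≡⟨ ⋆-distribʳ-+ (alt M) (delay (alt M)) f n ⟩
    (alt M ⋆ f) n Q.+ (delay (alt M) ⋆ f) n        ≡⟨ cong ((alt M ⋆ f) n Q.+_) (delay-⋆ (alt M) f n) ⟩
    (alt M ⋆ f) n Q.+ (alt M ⋆ delay f) n          ∎
  where open ≡-Reasoning

column : ℕ → ℕ → ℕ → ℚ
column r b i = ℕ→ℚ (binom (i + r) b)

alt-1-⋆-column : ∀ b → (alt 1 ⋆ column (suc b) (suc b)) ≗ column b b
alt-1-⋆-column b zero    = trans (alt-⋆-zero 1 (column (suc b) (suc b)))
                                  (cong ℕ→ℚ (trans (binom-diag (suc b)) (sym (binom-diag b))))
alt-1-⋆-column b (suc n) = begin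
    (alt 1 ⋆ column (suc b) (suc b)) (suc n)                   ≡⟨ alt-suc-⋆ 0 (column (suc b) (suc b)) n ⟩
    (alt 0 ⋆ column (suc b) (suc b)) (suc n) Q.- (alt 0 ⋆ column (suc b) (suc b)) n
      ≡⟨ cong₂ Q._-_ (alt-0-⋆ (column (suc b) (suc b)) (suc n)) (alt-0-⋆ (column (suc b) (suc b)) n) ⟩
    ℕ→ℚ (x + y) Q.- ℕ→ℚ y                                      ≡⟨ cong (Q._- ℕ→ℚ y) (ℕ→ℚ-+ x y) ⟩
    (ℕ→ℚ x Q.+ ℕ→ℚ y) Q.- ℕ→ℚ y
      ≡⟨ ℚS.solve 2 (λ x y → (x ℚS.:+ y) ℚS.:- y ℚS.:= x) refl (ℕ→ℚ x) (ℕ→ℚ y) ⟩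
    ℕ→ℚ x                                                      ≡⟨ cong (λ m → ℕ→ℚ (binom m b)) (ℕP.+-suc n b) ⟩
    column b b (suc n)                                         ∎
  where
  open ≡-Reasoning
  x = binom (n + suc b) b
  y = binom (n + suc b) (suc b)

alt-suc-⋆-column : ∀ b → (alt (suc b) ⋆ column b b) ≗ X^ 0
alt-suc-⋆-column zero    zero    = refl
alt-suc-⋆-column zero    (suc n) = trans (alt-suc-⋆ 0 (column 0 0) n)
  (trans (cong₂ Q._-_ (alt-0-⋆ (column 0 0) (suc n)) (alt-0-⋆ (column 0 0) n)) (QP.+-inverseʳ 1ℚ))
alt-suc-⋆-column (suc b) n = begin
    (alt (suc (suc b)) ⋆ column (suc b) (suc b)) n
      ≡⟨ cong (λ a → (alt a ⋆ column (suc b) (suc b)) n) (ℕP.+-comm 1 (suc b)) ⟩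
    (alt (suc b + 1) ⋆ column (suc b) (suc b)) n           ≡⟨ alt-+-⋆ (suc b) 1 (column (suc b) (suc b)) n ⟩
    (alt (suc b) ⋆ (alt 1 ⋆ column (suc b) (suc b))) n     ≡⟨ ⋆-congʳ (alt (suc b)) n (alt-1-⋆-column b) ⟩
    (alt (suc b) ⋆ column b b) n                           ≡⟨ alt-suc-⋆-column b n ⟩
    X^ 0 n                                                 ∎
  where open ≡-Reasoning

alt-⋆-X^0 : ∀ c e → (alt c ⋆ X^ 0) e ≡ alt c e
alt-⋆-X^0 c e = trans
  (sumTo-last e (λ j j<e → trans (cong (alt c j Q.*_) (X^-< (ℕP.m<n⇒0<n∸m j<e))) (QP.*-zeroʳ (alt c j))))
  (trans (cong (λ i → alt c e Q.* X^ 0 i) (ℕP.n∸n≡0 e)) (QP.*-identityʳ (alt c e)))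

alt-⋆-column : ∀ b c e → (alt (suc (b + c)) ⋆ column b b) e ≡ alt c e
alt-⋆-column b c e = begin
    (alt (suc (b + c)) ⋆ column b b) e          ≡⟨ cong (λ a → (alt a ⋆ column b b) e) (ℕP.+-comm (suc b) c) ⟩
    (alt (c + suc b) ⋆ column b b) e            ≡⟨ alt-+-⋆ c (suc b) (column b b) e ⟩
    (alt c ⋆ (alt (suc b) ⋆ column b b)) e      ≡⟨ ⋆-congʳ (alt c) e (alt-suc-⋆-column b) ⟩
    (alt c ⋆ X^ 0) e                            ≡⟨ alt-⋆-X^0 c e ⟩
    alt c e                                     ∎
  where open ≡-Reasoning

column-vanish : ∀ r {b} i → i + r < b → column r b i ≡ 0ℚ
column-vanish r i i+r<b = cong ℕ→ℚ (binom-< i+r<b)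

column-diag : ∀ r {b} i → i + r ≡ b → column r b i ≡ 1ℚ
column-diag r i refl = cong ℕ→ℚ (binom-diag (i + r))

column-delay : ∀ r {b} → r < b → column r b ≗ delay (column (suc r) b)
column-delay r     r<b zero    = column-vanish r 0 r<b
column-delay r {b} r<b (suc i) = cong (λ m → ℕ→ℚ (binom m b)) (sym (ℕP.+-suc i r))

column-below : ∀ r q i → i < q → column r (r + q) i ≡ 0ℚ
column-below r q i i<q = column-vanish r i (subst (i + r <_) (ℕP.+-comm q r) (ℕP.+-monoˡ-< r i<q))

⋆-column-shift : ∀ u r q e → (u ⋆ column r (r + q)) (q + e) ≡ (u ⋆ column (r + q) (r + q)) e
⋆-column-shift u r q e = trans (⋆-shift u q e (column-below r q)) (⋆-congʳ u e shifted)
  where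
  shifted : (λ i → column r (r + q) (q + i)) ≗ column (r + q) (r + q)
  shifted i = cong (λ m → ℕ→ℚ (binom m (r + q))) (reorder q i r)
    where
    reorder : ∀ q i r → q + i + r ≡ i + (r + q)
    reorder = solve-∀

alt-middle : ∀ d → alt (suc d + d) (suc d) Q.+ alt (suc d + d) d ≡ 0ℚ
alt-middle d rewrite binom-sym (suc d) d =
  ℚS.solve 2 (λ s x → (ℚS.:- s) ℚS.:* x ℚS.:+ s ℚS.:* x ℚS.:= ℚS.con 0ℚ) refl (sgn d) (ℕ→ℚ (binom (suc d + d) d))

alt-⋆-column-pair : ∀ a r q n → a + 2 * q ≡ (r + q) + 2 * n →
  (alt a ⋆ column r (r + q)) n Q.+ (alt a ⋆ delay (column r (r + q))) n ≡ X^ n q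
alt-⋆-column-pair a r q n a+2q≡b+2n with ℕP.<-cmp n q
... | tri< n<q _ _ = begin
    (alt a ⋆ column r (r + q)) n Q.+ (alt a ⋆ delay (column r (r + q))) n
      ≡⟨ cong₂ Q._+_ (⋆-vanish (alt a) n (column-below r q) n<q)
                     (⋆-vanish (alt a) n (delay-vanish (column-below r q)) (ℕP.m<n⇒m<1+n n<q)) ⟩
    0ℚ Q.+ 0ℚ ≡⟨ X^-< n<q ⟨
    X^ n q    ∎
  where open ≡-Reasoning
... | tri≈ _ refl _ = begin
    (alt a ⋆ column r (r + q)) q Q.+ (alt a ⋆ delay (column r (r + q))) q
      ≡⟨ cong₂ Q._+_ (cong (alt a ⋆ column r (r + q)) (sym (ℕP.+-identityʳ q)))
                     (⋆-vanish (alt a) q (delay-vanish (column-below r q)) (ℕP.n<1+n q)) ⟩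
    (alt a ⋆ column r (r + q)) (q + 0) Q.+ 0ℚ
      ≡⟨ cong (Q._+ 0ℚ) (⋆-column-shift (alt a) r q 0) ⟩
    (alt a ⋆ column (r + q) (r + q)) 0 Q.+ 0ℚ
      ≡⟨ cong (Q._+ 0ℚ) (trans (alt-⋆-zero a (column (r + q) (r + q))) (column-diag (r + q) 0 refl)) ⟩
    1ℚ Q.+ 0ℚ ≡⟨ X^-diag q ⟨
    X^ q q    ∎
  where open ≡-Reasoning
... | tri> _ _ q<n with n ∸ suc q | ℕP.m+[n∸m]≡n q<n
...   | d | refl = begin
    (alt a ⋆ column r b) (suc (q + d)) Q.+ (alt a ⋆ delay (column r b)) (suc (q + d))
      ≡⟨ cong₂ Q._+_ (cong (alt a ⋆ column r b) (sym (ℕP.+-suc q d))) (⋆-delayʳ (alt a) (column r b) (q + d)) ⟩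
    (alt a ⋆ column r b) (q + suc d) Q.+ (alt a ⋆ column r b) (q + d)
      ≡⟨ cong₂ Q._+_ (⋆-column-shift (alt a) r q (suc d)) (⋆-column-shift (alt a) r q d) ⟩
    (alt a ⋆ column b b) (suc d) Q.+ (alt a ⋆ column b b) d
      ≡⟨ cong₂ Q._+_ (evaluate (suc d)) (evaluate d) ⟩
    alt (suc d + d) (suc d) Q.+ alt (suc d + d) d
      ≡⟨ alt-middle d ⟩
    0ℚ ≡⟨ X^-> q<n ⟨
    X^ (suc q + d) q ∎
  where
  open ≡-Reasoning
  b = r + q
  rearrange : ∀ r q d → (r + q) + 2 * (suc q + d) ≡ suc ((r + q) + (suc d + d)) + 2 * q
  rearrange = solve-∀
  a≡ : a ≡ suc (b + (suc d + d))
  a≡ = ℕP.+-cancelʳ-≡ (2 * q) a _ (trans a+2q≡b+2n (rearrange r q d))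
  evaluate : ∀ e → (alt a ⋆ column b b) e ≡ alt (suc d + d) e
  evaluate e = trans (cong (λ a′ → (alt a′ ⋆ column b b) e) a≡) (alt-⋆-column b (suc d + d) e)

upTo-coeff : ∀ m c k → (∀ i → m < i → c i ≡ 0) → upTo m c k ≡ ℕ→ℚ (c k)
upTo-coeff m c k c-above with k ≤ᵇ m | ℕP.≤ᵇ-reflects-≤ k m
... | true  | _       = refl
... | false | ofⁿ k≰m = cong ℕ→ℚ (sym (c-above k (ℕP.≰⇒> k≰m)))

upTo-above : ∀ m c {k} → m < k → upTo m c k ≡ 0ℚ
upTo-above m c m<k rewrite ≤ᵇ-false m<k = refl

m<n⇒m+n<2*n : ∀ {m i} → m < i → m + i < 2 * i
m<n⇒m+n<2*n {m} {i} m<i = subst (m + i <_) (double i) (ℕP.+-monoˡ-< i m<i)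
  where
  double : ∀ i → i + i ≡ 2 * i
  double = solve-∀

P-above : ∀ {m k} → m < k → P m k ≡ 0ℚ
P-above {m} = upTo-above m (λ k → T k m)

Qp-above : ∀ {m k} → m < k → Qp m k ≡ 0ℚ
Qp-above {m} = upTo-above m (λ k → U k m)

calP-above : ∀ {m k} → m < k → calP m k ≡ 0ℚ
calP-above {m} = upTo-above m (λ k → binom (m + k) (2 * k))

P-coeff : ∀ m k → P m k ≡ column (suc k) (2 * k + 1) m Q.+ column k (2 * k + 1) m
P-coeff m k = trans (upTo-coeff m (λ i → T i m) k T-above)
  (trans (cong (λ t → ℕ→ℚ (binom t (2 * k + 1) + binom (m + k) (2 * k + 1))) (reassoc m k))
         (ℕ→ℚ-+ (binom (m + suc k) (2 * k + 1)) (binom (m + k) (2 * k + 1))))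
  where
  reassoc : ∀ m k → m + k + 1 ≡ m + suc k
  reassoc = solve-∀
  T-above : ∀ i → m < i → T i m ≡ 0
  T-above i m<i = cong₂ _+_ (binom-< (ℕP.+-monoˡ-< 1 (m<n⇒m+n<2*n m<i)))
                            (binom-< (ℕP.<-≤-trans (m<n⇒m+n<2*n m<i) (ℕP.m≤m+n (2 * i) 1)))

Qp-coeff : ∀ m k → Qp m (suc k) ≡ column (suc k) (2 * suc k) m Q.+ column k (2 * suc k) m
Qp-coeff m k = trans (upTo-coeff m (λ i → U i m) (suc k) U-above)
  (trans (cong (λ t → ℕ→ℚ (binom (m + suc k) (2 * suc k) + binom (t ∸ 1) (2 * suc k))) (ℕP.+-suc m k))
         (ℕ→ℚ-+ (binom (m + suc k) (2 * suc k)) (binom (m + k) (2 * suc k))))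
  where
  U-above : ∀ i → m < i → U i m ≡ 0
  U-above (suc i) m<i = cong₂ _+_ (binom-< (m<n⇒m+n<2*n m<i))
                                  (binom-< (ℕP.≤-<-trans (ℕP.m∸n≤m (m + suc i) 1) (m<n⇒m+n<2*n m<i)))

calP-coeff : ∀ m k → calP m k ≡ column k (2 * k) m
calP-coeff m k = upTo-coeff m (λ i → binom (m + i) (2 * i)) k (λ i m<i → binom-< (m<n⇒m+n<2*n m<i))

-- The coefficients of calQ (suc m); in its definition they are local to a where block.
calQ-coeffs : ℕ → ℕ → ℕ
calQ-coeffs m zero    = 0
calQ-coeffs m (suc i) = binom (m + suc i) (2 * suc i ∸ 1)

calQ-upTo : ∀ m k → calQ (suc m) k ≡ upTo (suc m) (calQ-coeffs m) k
calQ-upTo m zero    = refl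
calQ-upTo m (suc k) = refl

calQ-coeff : ∀ m k → calQ (suc m) (suc k) ≡ column (suc k) (2 * k + 1) m
calQ-coeff m k = trans (upTo-coeff (suc m) (calQ-coeffs m) (suc k) c-above)
                       (cong (λ b → ℕ→ℚ (binom (m + suc k) b)) (odd k))
  where
  odd : ∀ k → k + suc (k + 0) ≡ 2 * k + 1
  odd = solve-∀
  c-above : ∀ i → suc m < i → calQ-coeffs m i ≡ 0
  c-above (suc i) (s≤s m<i) = binom-< (subst₂ _<_ (sym (ℕP.+-suc m i)) (trans (ℕP.+-comm 1 (2 * i)) (sym (odd i)))
                                               (s≤s (m<n⇒m+n<2*n m<i)))

P-diag : ∀ m → P m m ≡ 1ℚ
P-diag m = trans (P-coeff m m)
  (cong₂ Q._+_ (column-diag (suc m) m (odd m)) (column-vanish m m (subst (m + m <_) (odd′ m) (ℕP.n<1+n (m + m)))))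
  where
  odd : ∀ m → m + suc m ≡ 2 * m + 1
  odd = solve-∀
  odd′ : ∀ m → suc (m + m) ≡ 2 * m + 1
  odd′ = solve-∀

Qp-diag : ∀ m → Qp (suc m) (suc m) ≡ 1ℚ
Qp-diag m = trans (Qp-coeff (suc m) m)
  (cong₂ Q._+_ (column-diag (suc m) (suc m) (double (suc m)))
               (column-vanish m (suc m) (subst (_< 2 * suc m) (ℕP.+-suc m m) (m<n⇒m+n<2*n (ℕP.n<1+n m)))))
  where
  double : ∀ m → m + m ≡ 2 * m
  double = solve-∀

Qp-diag≢0 : ∀ m → Qp m m ≢ 0ℚ
Qp-diag≢0 zero    ()
Qp-diag≢0 (suc m) = ≡1⇒≢0 (Qp-diag m)

calP-diag : ∀ m → calP m m ≡ 1ℚ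
calP-diag m = trans (calP-coeff m m) (column-diag m m (double m))
  where
  double : ∀ m → m + m ≡ 2 * m
  double = solve-∀

calQ-diag : ∀ m → calQ m m ≡ 1ℚ
calQ-diag zero    = refl
calQ-diag (suc m) = trans (calQ-coeff m m) (column-diag (suc m) m (odd m))
  where
  odd : ∀ m → m + suc m ≡ 2 * m + 1
  odd = solve-∀

calQ-above : ∀ {m k} → m < k → calQ m k ≡ 0ℚ
calQ-above {zero}      m<k = X^-< m<k
calQ-above {suc m} {k} m<k = trans (calQ-upTo m k) (upTo-above (suc m) (calQ-coeffs m) m<k)

alt-⋆-adjacent-columns : ∀ a b r q n {f : ℕ → ℚ} → b ≡ suc r + q → a + 2 * q ≡ b + 2 * n →
  (∀ i → f i ≡ column (suc r) b i Q.+ column r b i) → (alt a ⋆ f) n ≡ X^ n q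
alt-⋆-adjacent-columns a .(suc r + q) r q n {f} refl a+2q≡b+2n f≡ = begin
    (alt a ⋆ f) n                                            ≡⟨ ⋆-congʳ (alt a) n as-delay ⟩
    (alt a ⋆ (λ i → column (suc r) b i Q.+ delay (column (suc r) b) i)) n
      ≡⟨ ⋆-distribˡ-+ (alt a) (column (suc r) b) (delay (column (suc r) b)) n ⟩
    (alt a ⋆ column (suc r) b) n Q.+ (alt a ⋆ delay (column (suc r) b)) n
      ≡⟨ alt-⋆-column-pair a (suc r) q n a+2q≡b+2n ⟩
    X^ n q                                                   ∎
  where
  open ≡-Reasoning
  b = suc r + q
  as-delay : f ≗ (λ i → column (suc r) b i Q.+ delay (column (suc r) b) i)
  as-delay i = trans (f≡ i) (cong (column (suc r) b i Q.+_) (column-delay r (s≤s (ℕP.m≤m+n r q)) i))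

weighted-alt-⋆-column : ∀ M b r q n → b ≡ r + q → M + 2 * q ≡ b + 2 * n →
  (weighted-alt M ⋆ column r b) n ≡ X^ n q
weighted-alt-⋆-column M .(r + q) r q n refl M+2q≡b+2n =
  trans (weighted-alt-⋆ M (column r (r + q)) n) (alt-⋆-column-pair M r q n M+2q≡b+2n)

alt-even-row : ∀ a n → a ≡ suc (suc n + n) → alt a (suc n) Q.* 1ℚ Q.+ (alt a ⋆ (λ _ → ℕ→ℚ 2)) n ≡ 0ℚ
alt-even-row .(suc (suc n + n)) n refl = begin
    alt (suc c) (suc n) Q.* 1ℚ Q.+ (alt (suc c) ⋆ (λ _ → ℕ→ℚ 2)) n
      ≡⟨ cong₂ Q._+_ (trans (QP.*-identityʳ _) (alt-pascal c (suc n))) (⋆-congʳ (alt (suc c)) n (λ _ → ℕ→ℚ-+ 1 1)) ⟩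
    (alt c (suc n) Q.- alt c n) Q.+ (alt (suc c) ⋆ (λ i → column 0 0 i Q.+ column 0 0 i)) n
      ≡⟨ cong ((alt c (suc n) Q.- alt c n) Q.+_) (⋆-distribˡ-+ (alt (suc c)) (column 0 0) (column 0 0) n) ⟩
    (alt c (suc n) Q.- alt c n) Q.+ ((alt (suc c) ⋆ column 0 0) n Q.+ (alt (suc c) ⋆ column 0 0) n)
      ≡⟨ cong (λ t → (alt c (suc n) Q.- alt c n) Q.+ (t Q.+ t)) (alt-⋆-column 0 c n) ⟩
    (alt c (suc n) Q.- alt c n) Q.+ (alt c n Q.+ alt c n)
      ≡⟨ ℚS.solve 2 (λ x y → (x ℚS.:- y) ℚS.:+ (y ℚS.:+ y) ℚS.:= x ℚS.:+ y) refl (alt c (suc n)) (alt c n) ⟩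
    alt c (suc n) Q.+ alt c n
      ≡⟨ alt-middle n ⟩
    0ℚ ∎
  where
  open ≡-Reasoning
  c = suc n + n

X^-via-P : ∀ n k → X^ n k ≡ sumTo n (λ j → sgn j Q.* ℕ→ℚ (binom (2 * n + 1) j) Q.* P (n ∸ j) k)
X^-via-P n k = sym (alt-⋆-adjacent-columns (2 * n + 1) (2 * k + 1) k k n (odd k) (swap n k) (λ i → P-coeff i k))
  where
  odd : ∀ k → 2 * k + 1 ≡ suc k + k
  odd = solve-∀
  swap : ∀ n k → 2 * n + 1 + 2 * k ≡ 2 * k + 1 + 2 * n
  swap = solve-∀

X^-via-Qp : ∀ n k → X^ n k ≡ (sgn n Q.* ℕ→ℚ (binom (2 * n) n)) Q.* X^ 0 k
                             Q.+ sumBelow n (λ j → sgn j Q.* ℕ→ℚ (binom (2 * n) j) Q.* Qp (n ∸ j) k)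
X^-via-Qp zero    zero    = refl
X^-via-Qp (suc n) zero    = trans (X^-> {suc n} (s≤s z≤n))
  (sym (trans (cong (alt (2 * suc n) (suc n) Q.* 1ℚ Q.+_) (sym (sumTo-sumBelow n _)))
              (alt-even-row (2 * suc n) n (double n))))
  where
  double : ∀ n → 2 * suc n ≡ suc (suc n + n)
  double = solve-∀
X^-via-Qp n       (suc k) = sym (begin
    alt (2 * n) n Q.* 0ℚ Q.+ sumBelow n g          ≡⟨ cong₂ Q._+_ (QP.*-zeroʳ (alt (2 * n) n)) (sumBelow-as-sumTo) ⟩
    0ℚ Q.+ (alt (2 * n) ⋆ (λ i → Qp i (suc k))) n  ≡⟨ QP.+-identityˡ _ ⟩
    (alt (2 * n) ⋆ (λ i → Qp i (suc k))) n
      ≡⟨ alt-⋆-adjacent-columns (2 * n) (2 * suc k) k (suc k) n (double k) (ℕP.+-comm (2 * n) _) (λ i → Qp-coeff i k) ⟩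
    X^ n (suc k)                                   ∎)
  where
  open ≡-Reasoning
  g : ℕ → ℚ
  g j = alt (2 * n) j Q.* Qp (n ∸ j) (suc k)
  double : ∀ k → 2 * suc k ≡ suc k + suc k
  double = solve-∀
  sumBelow-as-sumTo : sumBelow n g ≡ sumTo n g
  sumBelow-as-sumTo = sym (trans (sumTo-sumBelow n g)
    (trans (cong (λ i → sumBelow n g Q.+ alt (2 * n) n Q.* Qp i (suc k)) (ℕP.n∸n≡0 n))
           (trans (cong (sumBelow n g Q.+_) (QP.*-zeroʳ (alt (2 * n) n))) (QP.+-identityʳ (sumBelow n g)))))

X^-via-calP : ∀ n k → X^ n k ≡ sumTo n (λ j → sgn j Q.* ℕ→ℚ (binom (2 * n + 1) j)
                                         Q.* ((+ (2 * n + 1) ℤ.- + (2 * j)) / suc (2 * n)) Q.* calP (n ∸ j) k)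
X^-via-calP n k rewrite ℕP.+-comm (2 * n) 1 = sym (trans
  (⋆-congʳ (weighted-alt (2 * n)) n (λ i → calP-coeff i k))
  (weighted-alt-⋆-column (2 * n) (2 * k) k k n (double k) (ℕP.+-comm (2 * n) (2 * k))))
  where
  double : ∀ k → 2 * k ≡ k + k
  double = solve-∀

X^-via-calQ : ∀ m k → X^ (suc m) k ≡ sumBelow (suc m) (λ j → sgn j Q.* ℕ→ℚ (binom (2 * suc m) j)
                                         Q.* ((+ (2 * suc m) ℤ.- + (2 * j)) / (2 * suc m)) Q.* calQ (suc m ∸ j) k)
X^-via-calQ m k = sym (begin
    sumBelow (suc m) (λ j → weighted-alt M j Q.* calQ (suc m ∸ j) k)   ≡⟨ sumTo-sumBelow m _ ⟨
    sumTo m (λ j → weighted-alt M j Q.* calQ (suc m ∸ j) k)            ≡⟨ sumTo-cong m reindex ⟩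
    (weighted-alt M ⋆ (λ i → calQ (suc i) k)) m                        ≡⟨ shifted k ⟩
    X^ (suc m) k                                                      ∎)
  where
  open ≡-Reasoning
  M = m + suc (m + 0)
  odd : ∀ k → 2 * k + 1 ≡ suc k + k
  odd = solve-∀
  swap : ∀ m k → m + suc (m + 0) + 2 * k ≡ 2 * k + 1 + 2 * m
  swap = solve-∀
  reindex : ∀ j → j ≤ m → weighted-alt M j Q.* calQ (suc m ∸ j) k ≡ weighted-alt M j Q.* calQ (suc (m ∸ j)) k
  reindex j j≤m = cong (λ i → weighted-alt M j Q.* calQ i k) (ℕP.+-∸-assoc 1 j≤m)
  shifted : ∀ k → (weighted-alt M ⋆ (λ i → calQ (suc i) k)) m ≡ X^ (suc m) k
  shifted zero    = trans (sumTo-zero m (λ j _ → QP.*-zeroʳ (weighted-alt M j))) (sym (X^-> {suc m} (s≤s z≤n)))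
  shifted (suc k) = begin
    (weighted-alt M ⋆ (λ i → calQ (suc i) (suc k))) m  ≡⟨ ⋆-congʳ (weighted-alt M) m (λ i → calQ-coeff i k) ⟩
    (weighted-alt M ⋆ column (suc k) (2 * k + 1)) m    ≡⟨ weighted-alt-⋆-column M (2 * k + 1) (suc k) k m (odd k) (swap m k) ⟩
    X^ m k                                             ≡⟨ X^-suc m k ⟨
    X^ (suc m) (suc k)                                 ∎

lemma2p1 :
    ((n k : ℕ) →
      X^ n k ≡ sumTo n (λ j → sgn j Q.* ℕ→ℚ (binom (2 * n + 1) j) Q.* P (n ∸ j) k))
    × ((n k : ℕ) →
      X^ n k ≡ (sgn n Q.* ℕ→ℚ (binom (2 * n) n)) Q.* X^ 0 k
                 Q.+ sumBelow n (λ j → sgn j Q.* ℕ→ℚ (binom (2 * n) j) Q.* Qp (n ∸ j) k))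
    × ((n k : ℕ) →
      X^ n k ≡ sumTo n (λ j → sgn j Q.* ℕ→ℚ (binom (2 * n + 1) j)
                 Q.* ((+ (2 * n + 1) ℤ.- + (2 * j)) / suc (2 * n)) Q.* calP (n ∸ j) k))
    × ((m k : ℕ) →
      X^ (suc m) k ≡ sumBelow (suc m) (λ j → sgn j Q.* ℕ→ℚ (binom (2 * suc m) j)
                 Q.* ((+ (2 * suc m) ℤ.- + (2 * j)) / (2 * suc m)) Q.* calQ (suc m ∸ j) k))
    × IsBasis P × IsBasis Qp × IsBasis calP × IsBasis calQ
lemma2p1 = X^-via-P , X^-via-Qp , X^-via-calP , X^-via-calQ
         , triangular-basis P    P-above    (λ m → ≡1⇒≢0 (P-diag m))
         , triangular-basis Qp   Qp-above   Qp-diag≢0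
         , triangular-basis calP calP-above (λ m → ≡1⇒≢0 (calP-diag m))
         , triangular-basis calQ calQ-above (λ m → ≡1⇒≢0 (calQ-diag m))
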